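{- If $X,Y$ are sets in a matroid $M$, then $\sqcap_M(X,Y)\ge r_M(X\cap Y)$. If moreover $\sqcap_M(X,Y)<\infty$, then equality holds if and only if $(X,Y)$ is a modular pair in $M$.
   Context: Matroids are possibly infinite (in the sense of Bruhn, Diestel, Kriesell, Pendavingh and Wollan); ranks and cardinalities take values in $\mathbb{N}\cup\{\infty\}$. The local connectivity of sets $X,Y$ is $\sqcap_M(X,Y)=|I\cap J|+r^*(M|(I\cup J))$, where $I,J$ are any bases for $X,Y$ respectively (the value is independent of the choice). A pair $(X,Y)$ is modular if there is an independent set $B$ of $M$ such that $B\cap X$ is a basis for $X$ and $B\cap Y$ is a basis for $Y$. -}

module Defs where

open import Level using (0ℓ)
open import Data.Nat using (ℕ; _+_; _≤_)
open import Data.Fin using (Fin)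
open import Data.Product using (Σ; ∃; _×_; _,_)
open import Data.Sum using (_⊎_)
open import Data.Unit using (⊤)
open import Data.Empty using (⊥)
open import Relation.Nullary using (¬_)
open import Relation.Binary.PropositionalEquality using (_≡_)
open import Relation.Unary using (Pred; _⊆_; _∩_; _∪_; ∅)
open import Function.Definitions using (Injective)

-- Subsets of a ground type E (the ground set of the matroid is all of E).
Subset : Set → Set₁
Subset E = Pred E 0ℓ

_∖_ : {E : Set} → Subset E → Subset E → Subset E
(A ∖ B) x = A x × ¬ B x

_＋_ : {E : Set} → Subset E → E → Subset E
(A ＋ e) x = A x ⊎ x ≡ e

IsMaximal : {E : Set} → (Subset E → Set) → Subset E → Set₁
IsMaximal {E} F A = F A × (∀ (B : Subset E) → F B → A ⊆ B → B ⊆ A)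

-- Infinite matroids (Bruhn–Diestel–Kriesell–Pendavingh–Wollan),
-- independence axioms (I1),(I2),(I3),(IM), on ground set E.
record Matroid (E : Set) : Set₁ where
  field
    Ind : Subset E → Set
    I1  : Ind ∅
    I2  : ∀ {I J : Subset E} → Ind J → I ⊆ J → Ind I
    I3  : ∀ {I I' : Subset E} → Ind I → ¬ IsMaximal Ind I → IsMaximal Ind I' →
          ∃ λ x → (I' ∖ I) x × Ind (I ＋ x)
    IM  : ∀ {I X : Subset E} → Ind I → I ⊆ X →
          ∃ λ (B : Subset E) → IsMaximal (λ J → Ind J × I ⊆ J × J ⊆ X) B
open Matroid public

IsBasis : {E : Set} → Matroid E → Subset E → Subset E → Set₁
IsBasis M X B = IsMaximal (λ J → Ind M J × J ⊆ X) B

data ℕ∞ : Set where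
  fin : ℕ → ℕ∞
  ∞   : ℕ∞

_+∞_ : ℕ∞ → ℕ∞ → ℕ∞
fin m +∞ fin n = fin (m + n)
fin _ +∞ ∞     = ∞
∞     +∞ _     = ∞

_≤∞_ : ℕ∞ → ℕ∞ → Set
fin m ≤∞ fin n = m ≤ n
fin _ ≤∞ ∞     = ⊤
∞     ≤∞ fin _ = ⊥
∞     ≤∞ ∞     = ⊤

HasFinCard : {E : Set} → Subset E → ℕ → Set
HasFinCard {E} A n = Σ (Fin n → E) λ f →
  Injective _≡_ _≡_ f × (∀ i → A (f i)) × (∀ x → A x → ∃ λ i → f i ≡ x)

Card : {E : Set} → Subset E → ℕ∞ → Set
Card A (fin n) = HasFinCard A n
Card A ∞       = ∀ n → ¬ HasFinCard A n

Rank : {E : Set} → Matroid E → Subset E → ℕ∞ → Set₁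
Rank M X k = ∃ λ B → IsBasis M X B × Card B k

-- r^*(M|Z) = k.  The dual of M|Z has as bases the complements in Z of the
-- bases of M|Z, i.e. of the bases of Z in M; so r^*(M|Z) is |Z \ B| for
-- any basis B of Z in M.
DualRankRestr : {E : Set} → Matroid E → Subset E → ℕ∞ → Set₁
DualRankRestr M Z k = ∃ λ B → IsBasis M Z B × Card (Z ∖ B) k

LocalConn : {E : Set} → Matroid E → Subset E → Subset E → ℕ∞ → Set₁
LocalConn M X Y k = ∃ λ I → ∃ λ J → IsBasis M X I × IsBasis M Y J ×
  ∃ λ a → ∃ λ b → Card (I ∩ J) a × DualRankRestr M (I ∪ J) b × k ≡ a +∞ b

ModularPair : {E : Set} → Matroid E → Subset E → Subset E → Set₁
ModularPair M X Y = ∃ λ B → Ind M B × IsBasis M X (B ∩ X) × IsBasis M Y (B ∩ Y)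

{-# OPTIONS --safe #-}
-- Fix bases I, J of X, Y. Extending I to a basis of I ∪ J gives a basis I ∪ Q with Q ⊆ J ∖ X,
-- and then |I ∩ J| + |(I ∪ J) ∖ (I ∪ Q)| = |J ∖ Q|. Whether I ∪ Q is a basis of I ∪ J does not
-- depend on the basis I of X, and by basis exchange |Z ∖ B| does not depend on the basis B of Z;
-- so the formula for ⊓ takes the same value for every choice of bases. Choosing I and J through
-- a common basis K of X ∩ Y makes I ∩ J = K, whence ⊓(X,Y) = r(X ∩ Y) + r*(M|(I ∪ J)): this is
-- the inequality, and equality holds iff I ∪ J is independent, which makes (X,Y) modular.
-- Conversely a modular pair has bases I, J with I ∪ J independent, so ⊓(X,Y) = |I ∩ J|, and
-- I ∩ J extends to a basis of X ∩ Y.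

module Submission where

open import Defs
open import Level using (0ℓ) renaming (suc to lsuc)
open import Axiom.ExcludedMiddle using (ExcludedMiddle)
open import Data.Nat using (ℕ; zero; suc; _+_; _≤_)
open import Data.Nat.Properties using (≤-antisym; suc-injective; m≤m+n; +-cancelˡ-≡; +-identityʳ)
open import Data.Fin using (Fin; zero; suc; splitAt; join)
open import Data.Fin.Properties using (¬Fin0; injective⇒≤; splitAt-join; join-splitAt)
open import Data.Product using (Σ; ∃; ∃₂; _×_; _,_; proj₁; proj₂)
open import Data.Sum using (_⊎_; inj₁; inj₂; [_,_]′; map; map₂)
open import Data.Empty using (⊥-elim)
open import Data.Unit using (⊤; tt)
open import Function.Bundles using (_⇔_; mk⇔; Equivalence)
open import Function using (id; _∘_)
open import Relation.Nullary using (¬_; yes; no)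
open import Relation.Binary.PropositionalEquality using (_≡_; refl; sym; trans; cong; subst)
open import Relation.Unary using (_⊆_; _∩_; _∪_; ∅; _≐_; ｛_｝)
open import Relation.Unary.Properties using (≐-refl; ≐-sym)
open import Relation.Unary.Algebra using (∩-comm; ∪-comm)

ConnValue : {E : Set} → Subset E → Subset E → Subset E → ℕ → Set
ConnValue I J B n = ∃₂ λ a b → HasFinCard (I ∩ J) a × HasFinCard ((I ∪ J) ∖ B) b × a + b ≡ n

record Frame {E : Set} (M : Matroid E) (X Y : Subset E) : Set₁ where
  constructor frame
  field
    {I J B} : Subset E
    I-basis : IsBasis M X I
    J-basis : IsBasis M Y J
    B-basis : IsBasis M (I ∪ J) B

  Value : ℕ → Set
  Value = ConnValue I J B

private variable
  E : Set
  A A′ B B′ B₁ B₂ C D I J J′ K P Q R X Y Z : Subset E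
  m n a b : ℕ
  x y z : E

-- Finite cardinalities

card-≐ : A ≐ C → HasFinCard A n → HasFinCard C n
card-≐ (A⊆C , C⊆A) (f , f-inj , f∈A , f-onto) =
  f , f-inj , A⊆C ∘ f∈A , λ x x∈C → f-onto x (C⊆A x∈C)

card-mono : A ⊆ C → HasFinCard A m → HasFinCard C n → m ≤ n
card-mono A⊆C (f , f-inj , f∈A , _) (g , _ , _ , g-onto) = injective⇒≤ h-inj
  where
  position : ∀ i → ∃ λ j → g j ≡ f i
  position i = g-onto (f i) (A⊆C (f∈A i))

  h-inj : ∀ {i j} → proj₁ (position i) ≡ proj₁ (position j) → i ≡ j
  h-inj {i} {j} eq = f-inj (trans (sym (proj₂ (position i))) (trans (cong g eq) (proj₂ (position j))))

card-unique : HasFinCard A m → HasFinCard A n → m ≡ n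
card-unique p q = ≤-antisym (card-mono id p q) (card-mono id q p)

card-0⇒empty : HasFinCard A 0 → A ⊆ ∅
card-0⇒empty (_ , _ , _ , f-onto) {x} x∈A with f-onto x x∈A
... | () , _

empty⇒card-0 : A ⊆ ∅ → HasFinCard A 0
empty⇒card-0 A⊆∅ = (λ ()) , (λ { {()} }) , (λ ()) , λ _ x∈A → ⊥-elim (A⊆∅ x∈A)

card-singleton : HasFinCard ｛ x ｝ 1
card-singleton {x = x} = (λ _ → x) , (λ { {zero} {zero} _ → refl }) , (λ _ → refl) , λ _ x≡y → zero , x≡y

card-inhabited : HasFinCard A (suc n) → ∃ A
card-inhabited (f , _ , f∈A , _) = f zero , f∈A zero

card-∪ : P ∩ Q ⊆ ∅ → HasFinCard P a → HasFinCard Q b → HasFinCard (P ∪ Q) (a + b)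
card-∪ {P = P} {Q = Q} {a = a} {b = b} disjoint (f , f-inj , f∈P , f-onto) (g , g-inj , g∈Q , g-onto) =
  [ f , g ]′ ∘ splitAt a , inj , ∈P∪Q ∘ splitAt a , onto
  where
  [f,g]-inj : ∀ {u v} → [ f , g ]′ u ≡ [ f , g ]′ v → u ≡ v
  [f,g]-inj {inj₁ i} {inj₁ j} eq = cong inj₁ (f-inj eq)
  [f,g]-inj {inj₁ i} {inj₂ j} eq = ⊥-elim (disjoint (f∈P i , subst Q (sym eq) (g∈Q j)))
  [f,g]-inj {inj₂ i} {inj₁ j} eq = ⊥-elim (disjoint (f∈P j , subst Q eq (g∈Q i)))
  [f,g]-inj {inj₂ i} {inj₂ j} eq = cong inj₂ (g-inj eq)

  inj : ∀ {i j} → [ f , g ]′ (splitAt a i) ≡ [ f , g ]′ (splitAt a j) → i ≡ j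
  inj {i} {j} eq = trans (sym (join-splitAt a b i))
    (trans (cong (join a b) ([f,g]-inj {splitAt a i} {splitAt a j} eq)) (join-splitAt a b j))

  ∈P∪Q : ∀ u → (P ∪ Q) ([ f , g ]′ u)
  ∈P∪Q (inj₁ i) = inj₁ (f∈P i)
  ∈P∪Q (inj₂ j) = inj₂ (g∈Q j)

  hit : ∀ u {y} → [ f , g ]′ u ≡ y → ∃ λ i → [ f , g ]′ (splitAt a i) ≡ y
  hit u eq = join a b u , trans (cong [ f , g ]′ (splitAt-join a b u)) eq

  onto : ∀ y → (P ∪ Q) y → ∃ λ i → [ f , g ]′ (splitAt a i) ≡ y
  onto y (inj₁ y∈P) = let i , fi≡y = f-onto y y∈P in hit (inj₁ i) fi≡y
  onto y (inj₂ y∈Q) = let j , gj≡y = g-onto y y∈Q in hit (inj₂ j) gj≡y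

singleton-disjoint : ｛ x ｝ ∩ (A ∖ ｛ x ｝) ⊆ ∅
singleton-disjoint (x≡y , _ , x≢y) = x≢y x≡y

image-tail : (g : Fin (suc n) → E) → (∀ x → A x → ∃ λ i → g i ≡ x) →
             ∀ x → (A ∖ ｛ g zero ｝) x → ∃ λ i → g (suc i) ≡ x
image-tail g A⊆img x (x∈A , g0≢x) with A⊆img x x∈A
... | zero  , g0≡x = ⊥-elim (g0≢x g0≡x)
... | suc i , gi≡x = i , gi≡x

complement-split-disjoint : ((Z ∖ A) ∖ C) ∩ (C ∖ A) ⊆ ∅
complement-split-disjoint ((_ , c∉) , c , _) = c∉ c

complement-swap : (Z ∖ A) ∖ C ≐ (Z ∖ C) ∖ A
complement-swap = (λ ((z , a∉) , c∉) → (z , c∉) , a∉) , (λ ((z , c∉) , a∉) → (z , a∉) , c∉)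

＋-⊆ : A ⊆ C → C x → (A ＋ x) ⊆ C
＋-⊆ A⊆C x∈C (inj₁ a) = A⊆C a
＋-⊆ A⊆C x∈C (inj₂ refl) = x∈C

＋-mono : A ⊆ C → (A ＋ x) ⊆ (C ＋ x)
＋-mono A⊆C (inj₁ a) = inj₁ (A⊆C a)
＋-mono A⊆C (inj₂ e) = inj₂ e

＋-∪-assoc : (A ∪ C) ＋ x ≐ A ∪ (C ＋ x)
＋-∪-assoc =
  (λ { (inj₁ (inj₁ a)) → inj₁ a ; (inj₁ (inj₂ c)) → inj₂ (inj₁ c) ; (inj₂ e) → inj₂ (inj₂ e) }) ,
  (λ { (inj₁ a) → inj₁ (inj₁ a) ; (inj₂ (inj₁ c)) → inj₁ (inj₂ c) ; (inj₂ (inj₂ e)) → inj₂ e })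

⊆∪-∖ : A ⊆ Z → C ⊆ A ∪ D → C ∖ Z ⊆ D
⊆∪-∖ A⊆Z C⊆A∪D (c , z∉) with C⊆A∪D c
... | inj₁ a = ⊥-elim (z∉ (A⊆Z a))
... | inj₂ d = d

∖-congˡ : A ≐ C → A ∖ D ≐ C ∖ D
∖-congˡ (A⊆C , C⊆A) = (λ (a , d∉) → A⊆C a , d∉) , (λ (c , d∉) → C⊆A c , d∉)

module _ (em : ExcludedMiddle 0ℓ) where

  split-off : A ⊆ ｛ x ｝ ∪ (A ∖ ｛ x ｝)
  split-off {x = x} {y} y∈A with em {x ≡ y}
  ... | yes x≡y = inj₁ x≡y
  ... | no  x≢y = inj₂ (y∈A , x≢y)

  split-off-≐ : A x → A ≐ ｛ x ｝ ∪ (A ∖ ｛ x ｝)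
  split-off-≐ {A = A} x∈A = split-off {A = A} , [ (λ { refl → x∈A }) , proj₁ ]′

  image-finite : (g : Fin n → E) → (∀ x → A x → ∃ λ i → g i ≡ x) → ∃ λ m → HasFinCard A m
  image-finite {n = zero} g A⊆img = 0 , empty⇒card-0 λ {x} x∈A → ¬Fin0 (proj₁ (A⊆img x x∈A))
  image-finite {n = suc n} {A = A} g A⊆img with image-finite (g ∘ suc) (image-tail g A⊆img) | em {A (g zero)}
  ... | m , rest-card | yes g0∈A =
    suc m , card-≐ (≐-sym (split-off-≐ {A = A} g0∈A))
                    (card-∪ (singleton-disjoint {A = A}) card-singleton rest-card)
  ... | m , rest-card | no  g0∉A =
    m , card-≐ (proj₁ , λ y∈A → y∈A , λ { refl → g0∉A y∈A }) rest-card

  card-finite-⊆ : A ⊆ C → HasFinCard C n → ∃ λ m → HasFinCard A m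
  card-finite-⊆ A⊆C (g , _ , _ , g-onto) = image-finite g λ x x∈A → g-onto x (A⊆C x∈A)

  card-∪⁻ : P ∩ Q ⊆ ∅ → HasFinCard (P ∪ Q) n →
            ∃₂ λ a b → HasFinCard P a × HasFinCard Q b × a + b ≡ n
  card-∪⁻ disjoint h =
    let a , hP = card-finite-⊆ inj₁ h
        b , hQ = card-finite-⊆ inj₂ h
    in a , b , hP , hQ , card-unique (card-∪ disjoint hP hQ) h

  card-remove : A x → HasFinCard A (suc n) → HasFinCard (A ∖ ｛ x ｝) n
  card-remove {A = A} x∈A h with card-∪⁻ (singleton-disjoint {A = A}) (card-≐ (split-off-≐ {A = A} x∈A) h)
  ... | a , b , h-single , h-rest , a+b≡1+n with card-unique card-singleton h-single
  ... | refl = subst (HasFinCard _) (suc-injective a+b≡1+n) h-rest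

  card-∪-cong : P ∩ Q ⊆ ∅ → R ∩ C ⊆ ∅ →
                (∀ {k} → HasFinCard P k → HasFinCard R k) → (∀ {k} → HasFinCard Q k → HasFinCard C k) →
                HasFinCard (P ∪ Q) n → HasFinCard (R ∪ C) n
  card-∪-cong P⊥Q R⊥C P→R Q→C h with card-∪⁻ P⊥Q h
  ... | a , b , hP , hQ , refl = card-∪ R⊥C (P→R hP) (Q→C hQ)

  complement-split : C ⊆ Z → Z ∖ A ≐ ((Z ∖ A) ∖ C) ∪ (C ∖ A)
  complement-split {C = C} {Z = Z} {A = A} C⊆Z = split , [ proj₁ , (λ (c , a∉) → C⊆Z c , a∉) ]′
    where
    split : Z ∖ A ⊆ ((Z ∖ A) ∖ C) ∪ (C ∖ A)
    split {x} (z , a∉) with em {C x}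
    ... | yes c = inj₂ (c , a∉)
    ... | no  c∉ = inj₁ ((z , a∉) , c∉)

  conn-value-count : Q ∩ A ⊆ ∅ → ConnValue A J (A ∪ Q) n ⇔ HasFinCard (J ∖ Q) n
  conn-value-count {Q = Q} {A = A} {J = J} Q⊥A =
    mk⇔ (λ (a , b , h∩ , h∖ , eq) →
           subst (HasFinCard (J ∖ Q)) eq (card-≐ (≐-sym partition) (card-∪ disjoint h∩ h∖)))
        (λ h → card-∪⁻ disjoint (card-≐ partition h))
    where
    disjoint : (A ∩ J) ∩ ((A ∪ J) ∖ (A ∪ Q)) ⊆ ∅
    disjoint ((a , _) , _ , a∪q∉) = a∪q∉ (inj₁ a)

    split : J ∖ Q ⊆ (A ∩ J) ∪ ((A ∪ J) ∖ (A ∪ Q))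
    split {y} (j , q∉) with em {A y}
    ... | yes a = inj₁ (a , j)
    ... | no  a∉ = inj₂ (inj₂ j , [ a∉ , q∉ ]′)

    partition : J ∖ Q ≐ (A ∩ J) ∪ ((A ∪ J) ∖ (A ∪ Q))
    partition = split , [ (λ (a , j) → j , λ q → Q⊥A (q , a)) ,
                          (λ (a∪j , a∪q∉) → [ ⊥-elim ∘ a∪q∉ ∘ inj₁ , id ]′ a∪j , a∪q∉ ∘ inj₂) ]′

conn-value-comm : ConnValue A C D n → ConnValue C A D n
conn-value-comm {A = A} {C = C} (a , b , h∩ , h∖ , eq) =
  a , b , card-≐ (∩-comm A C) h∩ , card-≐ (∖-congˡ (∪-comm A C)) h∖ , eq

module Properties (em : ExcludedMiddle 0ℓ) (em1 : ExcludedMiddle (lsuc 0ℓ)) {E : Set} (M : Matroid E) where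

  -- Bases and closure

  IsBase : Subset E → Set₁
  IsBase = IsMaximal (Ind M)

  -- The closure of I, as long as I is independent.
  cl : Subset E → Subset E
  cl I x = I x ⊎ ¬ Ind M (I ＋ x)

  basis-ind : IsBasis M X B → Ind M B
  basis-ind ((B-ind , _) , _) = B-ind

  basis-⊆ : IsBasis M X B → B ⊆ X
  basis-⊆ ((_ , B⊆X) , _) = B⊆X

  basis-max : IsBasis M X B → Ind M C → C ⊆ X → B ⊆ C → C ⊆ B
  basis-max {C = C} (_ , maximal) C-ind C⊆X = maximal C (C-ind , C⊆X)

  basis-trace : IsBasis M X B → Ind M C → B ⊆ C → C ∩ X ⊆ B
  basis-trace B-basis C-ind B⊆C =
    basis-max B-basis (I2 M C-ind proj₁) proj₂ (λ b → B⊆C b , basis-⊆ B-basis b)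

  basis-≐ : X ≐ Y → A ≐ B → IsBasis M X A → IsBasis M Y B
  basis-≐ {Y = Y} {B = B} (X⊆Y , Y⊆X) (A⊆B , B⊆A) A-basis =
    (I2 M (basis-ind A-basis) B⊆A , λ b → X⊆Y (basis-⊆ A-basis (B⊆A b))) , maximal
    where
    maximal : ∀ C → Ind M C × C ⊆ Y → B ⊆ C → C ⊆ B
    maximal C (C-ind , C⊆Y) B⊆C c =
      A⊆B (basis-max A-basis C-ind (λ c′ → Y⊆X (C⊆Y c′)) (λ a → B⊆C (A⊆B a)) c)

  self-basis : Ind M A → IsBasis M A A
  self-basis A-ind = (A-ind , λ a → a) , λ _ (_ , C⊆A) _ → C⊆A

  basis-∩ : IsBasis M X A → Ind M B → A ⊆ B → IsBasis M X (B ∩ X)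
  basis-∩ A-basis B-ind A⊆B =
    basis-≐ ≐-refl ((λ a → A⊆B a , basis-⊆ A-basis a) , basis-trace A-basis B-ind A⊆B) A-basis

  basis-extending : Ind M K → K ⊆ X → ∃ λ B → IsBasis M X B × K ⊆ B
  basis-extending K-ind K⊆X with IM M K-ind K⊆X
  ... | B , (B-ind , K⊆B , B⊆X) , maximal =
    B , ((B-ind , B⊆X) , λ C (C-ind , C⊆X) B⊆C → maximal C (C-ind , (λ k → B⊆C (K⊆B k)) , C⊆X) B⊆C) , K⊆B

  basis-exists : (X : Subset E) → ∃ (IsBasis M X)
  basis-exists X with basis-extending {X = X} (I1 M) (λ ())
  ... | B , B-basis , _ = B , B-basis

  base-extending : Ind M K → ∃ λ B → IsBase B × K ⊆ B
  base-extending K-ind with basis-extending {X = λ _ → ⊤} K-ind (λ _ → tt)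
  ... | B , ((B-ind , _) , maximal) , K⊆B = B , (B-ind , λ C C-ind → maximal C (C-ind , λ _ → tt)) , K⊆B

  base-max : IsBase B → Ind M C → B ⊆ C → C ⊆ B
  base-max {C = C} (_ , maximal) = maximal C

  base-between : IsBase B → Ind M K → ∃ λ T → IsBase T × K ⊆ T × T ⊆ K ∪ B
  base-between {B = B} {K = K} B-base K-ind with basis-extending {X = K ∪ B} K-ind inj₁
  ... | T , T-basis , K⊆T with em1 {IsBase T}
  ...   | yes T-base = T , T-base , K⊆T , basis-⊆ T-basis
  ...   | no ¬T-base with I3 M (basis-ind T-basis) ¬T-base B-base
  ...     | x , (x∈B , x∉T) , T+x-ind =
    ⊥-elim (x∉T (basis-max T-basis T+x-ind (＋-⊆ (basis-⊆ T-basis) (inj₂ x∈B)) inj₁ (inj₂ refl)))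

  cl-mono : I ⊆ J → cl I ⊆ cl J
  cl-mono I⊆J (inj₁ x∈I) = inj₁ (I⊆J x∈I)
  cl-mono {I = I} {J = J} I⊆J {x} (inj₂ I+x-dep) =
    inj₂ λ J+x-ind → I+x-dep (I2 M J+x-ind (＋-mono {A = I} {C = J} {x = x} I⊆J))

  cl-trace : Ind M C → I ⊆ C → C ∩ cl I ⊆ I
  cl-trace C-ind I⊆C (_ , inj₁ x∈I) = x∈I
  cl-trace C-ind I⊆C (x∈C , inj₂ I+x-dep) = ⊥-elim (I+x-dep (I2 M C-ind (＋-⊆ I⊆C x∈C)))

  removed-not-spanned : Ind M B → B y → ¬ cl (B ∖ ｛ y ｝) y
  removed-not-spanned B-ind y∈B (inj₁ (_ , y≢y)) = y≢y refl
  removed-not-spanned {B = B} {y = y} B-ind y∈B (inj₂ dep) =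
    dep (I2 M B-ind (＋-⊆ {A = B ∖ ｛ y ｝} proj₁ y∈B))

  basis-spans : IsBasis M X B → X ⊆ cl B
  basis-spans {B = B} B-basis {x} x∈X with em {B x}
  ... | yes x∈B = inj₁ x∈B
  ... | no  x∉B = inj₂ λ B+x-ind →
    x∉B (basis-max B-basis B+x-ind (＋-⊆ (basis-⊆ B-basis) x∈X) inj₁ (inj₂ refl))

  spanning-basis : Ind M B → B ⊆ X → X ⊆ cl B → IsBasis M X B
  spanning-basis {B = B} {X = X} B-ind B⊆X X⊆clB = (B-ind , B⊆X) , maximal
    where
    maximal : ∀ C → Ind M C × C ⊆ X → B ⊆ C → C ⊆ B
    maximal C (C-ind , C⊆X) B⊆C c = cl-trace C-ind B⊆C (c , X⊆clB (C⊆X c))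

  -- The substitute for transitivity of closure. If z ∈ X ∖ I with I + z independent, take bases
  -- B₀ ⊇ J, then I ⊆ D ⊆ I ∪ B₀, I + z ⊆ F ⊆ (I + z) ∪ D and J ⊆ G ⊆ J ∪ F. Outside X each of
  -- G, F, D lies in the next one; inside X, both G and B₀ meet X in J and D meets X in I.
  -- Hence G = B₀, then D = F, and z ∈ F ∩ X = D ∩ X ⊆ I.
  spans-basis⇒spans : IsBasis M X J → Ind M I → I ⊆ X → J ⊆ cl I → X ⊆ cl I
  spans-basis⇒spans {X = X} {J = J} {I = I} J-basis I-ind I⊆X J⊆clI {z} z∈X with em {I z}
  ... | yes z∈I = inj₁ z∈I
  ... | no  z∉I = inj₂ I+z-dep
    where
    J-ind : Ind M J
    J-ind = basis-ind J-basis

    I+z-dep : ¬ Ind M (I ＋ z)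
    I+z-dep I+z-ind with base-extending J-ind
    ... | B₀ , B₀-base , J⊆B₀ with base-between B₀-base I-ind
    ... | D , D-base , I⊆D , D⊆I∪B₀ with base-between D-base I+z-ind
    ... | F , F-base , I+z⊆F , F⊆I+z∪D with base-between F-base J-ind
    ... | G , G-base , J⊆G , G⊆J∪F = z∉I (D∩X⊆I (F⊆D (I+z⊆F (inj₂ refl))) z∈X)
      where
      D∩X⊆I : ∀ {y} → D y → X y → I y
      D∩X⊆I {y} y∈D y∈X with D⊆I∪B₀ y∈D
      ... | inj₁ y∈I  = y∈I
      ... | inj₂ y∈B₀ =
        cl-trace (proj₁ D-base) I⊆D
          (y∈D , J⊆clI (basis-trace J-basis (proj₁ B₀-base) J⊆B₀ (y∈B₀ , y∈X)))

      D∖X⊆B₀ : D ∖ X ⊆ B₀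
      D∖X⊆B₀ = ⊆∪-∖ {A = I} I⊆X D⊆I∪B₀

      F∖X⊆D : F ∖ X ⊆ D
      F∖X⊆D = ⊆∪-∖ {A = I ＋ z} (＋-⊆ I⊆X z∈X) F⊆I+z∪D

      G∖X⊆F : G ∖ X ⊆ F
      G∖X⊆F = ⊆∪-∖ {A = J} (basis-⊆ J-basis) G⊆J∪F

      G⊆B₀ : G ⊆ B₀
      G⊆B₀ {y} y∈G with em {X y}
      ... | yes y∈X = J⊆B₀ (basis-trace J-basis (proj₁ G-base) J⊆G (y∈G , y∈X))
      ... | no  y∉X = D∖X⊆B₀ (F∖X⊆D (G∖X⊆F (y∈G , y∉X) , y∉X) , y∉X)

      D⊆F : D ⊆ F
      D⊆F {y} y∈D with em {X y}
      ... | yes y∈X = I+z⊆F (inj₁ (D∩X⊆I y∈D y∈X))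
      ... | no  y∉X = G∖X⊆F (base-max G-base (proj₁ B₀-base) G⊆B₀ (D∖X⊆B₀ (y∈D , y∉X)) , y∉X)

      F⊆D : F ⊆ D
      F⊆D = base-max D-base (proj₁ F-base) D⊆F

  augment : IsBasis M Z J → Ind M I → I ⊆ Z → Z z → ¬ cl I z → ∃ λ x → (J ∖ I) x × Ind M (I ＋ x)
  augment {J = J} {I = I} J-basis I-ind I⊆Z z∈Z z∉clI with em {∃ λ x → (J ∖ I) x × Ind M (I ＋ x)}
  ... | yes found = found
  ... | no  none  = ⊥-elim (z∉clI (spans-basis⇒spans J-basis I-ind I⊆Z J⊆clI z∈Z))
    where
    J⊆clI : J ⊆ cl I
    J⊆clI {x} x∈J with em {I x}
    ... | yes x∈I = inj₁ x∈I
    ... | no  x∉I = inj₂ λ I+x-ind → none (x , (x∈J , x∉I) , I+x-ind)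

  basis-exchange : IsBasis M Z B₁ → IsBasis M Z B₂ → (B₂ ∖ B₁) y →
                   ∃ λ x → (B₁ ∖ B₂) x × IsBasis M Z ((B₂ ∖ ｛ y ｝) ＋ x)
  basis-exchange {Z = Z} {B₁ = B₁} {B₂ = B₂} {y = y} B₁-basis B₂-basis (y∈B₂ , y∉B₁)
    with augment B₁-basis (I2 M {I = B₂ ∖ ｛ y ｝} (basis-ind B₂-basis) proj₁)
                 (λ w → basis-⊆ B₂-basis (proj₁ w))
                 (basis-⊆ B₂-basis y∈B₂) (removed-not-spanned (basis-ind B₂-basis) y∈B₂)
  ... | x , (x∈B₁ , x∉B₂-y) , B₂′-ind = x , (x∈B₁ , x∉B₂) , spanning-basis B₂′-ind B₂′⊆Z Z⊆clB₂′
    where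
    B₂′ : Subset E
    B₂′ = (B₂ ∖ ｛ y ｝) ＋ x

    x∉B₂ : ¬ B₂ x
    x∉B₂ x∈B₂ = x∉B₂-y (x∈B₂ , λ { refl → y∉B₁ x∈B₁ })

    B₂′⊆Z : B₂′ ⊆ Z
    B₂′⊆Z = ＋-⊆ {A = B₂ ∖ ｛ y ｝} (λ w → basis-⊆ B₂-basis (proj₁ w)) (basis-⊆ B₁-basis x∈B₁)

    B₂+x⊆B₂′+y : (B₂ ＋ x) ⊆ (B₂′ ＋ y)
    B₂+x⊆B₂′+y (inj₁ w∈B₂) with split-off em {A = B₂} {x = y} w∈B₂
    ... | inj₁ y≡w    = inj₂ (sym y≡w)
    ... | inj₂ w∈B₂-y = inj₁ (inj₁ w∈B₂-y)
    B₂+x⊆B₂′+y (inj₂ w≡x) = inj₁ (inj₂ w≡x)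

    B₂⊆clB₂′ : B₂ ⊆ cl B₂′
    B₂⊆clB₂′ {w} w∈B₂ with em {y ≡ w}
    ... | no  y≢w  = inj₁ (inj₁ (w∈B₂ , y≢w))
    ... | yes refl = inj₂ λ B₂′+y-ind → [ x∉B₂ , (λ dep → dep (I2 M B₂′+y-ind B₂+x⊆B₂′+y)) ]′
                                          (basis-spans B₂-basis (basis-⊆ B₁-basis x∈B₁))

    Z⊆clB₂′ : Z ⊆ cl B₂′
    Z⊆clB₂′ = spans-basis⇒spans B₂-basis B₂′-ind B₂′⊆Z B₂⊆clB₂′

  -- A basis T of A′ ∪ Q through A′ is a basis of X ∪ Q spanned by the independent set
  -- A ∪ (Q ∩ T), so that set spans Q; inside the independent set A ∪ Q this forces Q ⊆ T.
  independent-basis-swap : IsBasis M X A → IsBasis M X A′ → Q ∩ X ⊆ ∅ → Ind M (A ∪ Q) → Ind M (A′ ∪ Q)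
  independent-basis-swap {X = X} {A = A} {A′ = A′} {Q = Q} A-basis A′-basis Q⊥X A∪Q-ind
    with basis-extending {X = A′ ∪ Q} (basis-ind A′-basis) inj₁
  ... | T , T-basis , A′⊆T = I2 M (basis-ind T-basis) A′∪Q⊆T
    where
    I₀ : Subset E
    I₀ = A ∪ (Q ∩ T)

    I₀⊆A∪Q : I₀ ⊆ A ∪ Q
    I₀⊆A∪Q = map₂ proj₁

    T-spans-X∪Q : IsBasis M (X ∪ Q) T
    T-spans-X∪Q = spanning-basis (basis-ind T-basis) (λ t → map (basis-⊆ A′-basis) id (basis-⊆ T-basis t))
      [ (λ x → cl-mono A′⊆T (basis-spans A′-basis x)) , (λ q → basis-spans T-basis (inj₂ q)) ]′

    T⊆clI₀ : T ⊆ cl I₀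
    T⊆clI₀ t with basis-⊆ T-basis t
    ... | inj₁ a′ = cl-mono inj₁ (basis-spans A-basis (basis-⊆ A′-basis a′))
    ... | inj₂ q  = inj₁ (inj₂ (q , t))

    A′∪Q⊆T : A′ ∪ Q ⊆ T
    A′∪Q⊆T (inj₁ a′) = A′⊆T a′
    A′∪Q⊆T (inj₂ q) with cl-trace A∪Q-ind I₀⊆A∪Q
           (inj₂ q , spans-basis⇒spans T-spans-X∪Q (I2 M A∪Q-ind I₀⊆A∪Q)
                       (map (basis-⊆ A-basis) proj₁) T⊆clI₀ (inj₂ q))
    ... | inj₁ a       = ⊥-elim (Q⊥X (q , basis-⊆ A-basis a))
    ... | inj₂ (_ , t) = t

  cl-basis-swap : IsBasis M X A → IsBasis M X A′ → Q ∩ X ⊆ ∅ → cl (A ∪ Q) ⊆ cl (A′ ∪ Q)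
  cl-basis-swap {X = X} {A = A} {A′ = A′} {Q = Q} A-basis A′-basis Q⊥X {y} y∈cl with em {X y}
  ... | yes y∈X = cl-mono inj₁ (basis-spans A′-basis y∈X)
  ... | no  y∉X with y∈cl
  ...   | inj₁ (inj₁ a) = ⊥-elim (y∉X (basis-⊆ A-basis a))
  ...   | inj₁ (inj₂ q) = inj₁ (inj₂ q)
  ...   | inj₂ A∪Q+y-dep = inj₂ λ A′∪Q+y-ind → A∪Q+y-dep (I2 M
            (independent-basis-swap A′-basis A-basis Q+y⊥X
              (I2 M A′∪Q+y-ind (proj₂ (＋-∪-assoc {A = A′} {C = Q}))))
            (proj₁ (＋-∪-assoc {A = A} {C = Q})))
    where
    Q+y⊥X : (Q ＋ y) ∩ X ⊆ ∅
    Q+y⊥X (inj₁ q , x) = Q⊥X (q , x)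
    Q+y⊥X (inj₂ refl , x) = y∉X x

  basis-swap : IsBasis M X A → IsBasis M X A′ → Q ∩ X ⊆ ∅ → Q ⊆ J →
               IsBasis M (A ∪ J) (A ∪ Q) → IsBasis M (A′ ∪ J) (A′ ∪ Q)
  basis-swap {A′ = A′} {Q = Q} {J = J} A-basis A′-basis Q⊥X Q⊆J A∪Q-basis =
    spanning-basis (independent-basis-swap A-basis A′-basis Q⊥X (basis-ind A∪Q-basis)) (map₂ Q⊆J) spans
    where
    spans : A′ ∪ J ⊆ cl (A′ ∪ Q)
    spans (inj₁ a′) = inj₁ (inj₁ a′)
    spans (inj₂ j) = cl-basis-swap A-basis A′-basis Q⊥X (basis-spans A∪Q-basis (inj₂ j))

  extend-basis-outside : IsBasis M X A → ∃ λ Q → Q ∩ X ⊆ ∅ × Q ⊆ J × IsBasis M (A ∪ J) (A ∪ Q)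
  extend-basis-outside {X = X} {A = A} {J = J} A-basis with basis-extending {X = A ∪ J} (basis-ind A-basis) inj₁
  ... | B , B-basis , A⊆B =
    B ∖ X , (λ ((_ , x∉) , x) → x∉ x) , ⊆∪-∖ {A = A} (basis-⊆ A-basis) (basis-⊆ B-basis) ,
    basis-≐ ≐-refl (split , [ A⊆B , proj₁ ]′) B-basis
    where
    split : B ⊆ A ∪ (B ∖ X)
    split {y} y∈B with em {X y}
    ... | yes y∈X = inj₁ (basis-trace A-basis (basis-ind B-basis) A⊆B (y∈B , y∈X))
    ... | no  y∉X = inj₂ (y∈B , y∉X)

  -- Invariance of the formula for ⊓

  basis-diff-card : IsBasis M Z B₁ → IsBasis M Z B₂ → HasFinCard (B₂ ∖ B₁) n → HasFinCard (B₁ ∖ B₂) n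
  basis-diff-card {B₁ = B₁} {B₂ = B₂} {n = zero} B₁-basis B₂-basis h =
    empty⇒card-0 λ (b₁ , b₂∉) → b₂∉ (B₁⊆B₂ b₁)
    where
    B₂⊆B₁ : B₂ ⊆ B₁
    B₂⊆B₁ {y} y∈B₂ with em {B₁ y}
    ... | yes y∈B₁ = y∈B₁
    ... | no  y∉B₁ = ⊥-elim (card-0⇒empty h (y∈B₂ , y∉B₁))

    B₁⊆B₂ : B₁ ⊆ B₂
    B₁⊆B₂ = basis-max B₂-basis (basis-ind B₁-basis) (basis-⊆ B₁-basis) B₂⊆B₁
  basis-diff-card {B₁ = B₁} {B₂ = B₂} {n = suc n} B₁-basis B₂-basis h with card-inhabited h
  ... | y , y∈B₂∖B₁@(_ , y∉B₁) with basis-exchange B₁-basis B₂-basis y∈B₂∖B₁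
  ... | x , (x∈B₁ , x∉B₂) , B₂′-basis =
    card-≐ B₁∖B₂≐ (card-∪ disjoint card-singleton
      (basis-diff-card B₁-basis B₂′-basis (card-≐ B₂′∖B₁≐ (card-remove em y∈B₂∖B₁ h))))
    where
    B₂′ : Subset E
    B₂′ = (B₂ ∖ ｛ y ｝) ＋ x

    B₂′∖B₁≐ : (B₂ ∖ B₁) ∖ ｛ y ｝ ≐ B₂′ ∖ B₁
    B₂′∖B₁≐ = (λ ((w∈B₂ , w∉B₁) , y≢w) → inj₁ (w∈B₂ , y≢w) , w∉B₁) ,
              λ { (inj₁ (w∈B₂ , y≢w) , w∉B₁) → (w∈B₂ , w∉B₁) , y≢w
                ; (inj₂ refl , x∉B₁) → ⊥-elim (x∉B₁ x∈B₁) }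

    disjoint : ｛ x ｝ ∩ (B₁ ∖ B₂′) ⊆ ∅
    disjoint (refl , _ , x∉B₂′) = x∉B₂′ (inj₂ refl)

    B₁∖B₂≐ : ｛ x ｝ ∪ (B₁ ∖ B₂′) ≐ B₁ ∖ B₂
    B₁∖B₂≐ = [ (λ { refl → x∈B₁ , x∉B₂ }) , from-B₂′ ]′ , to-B₂′
      where
      from-B₂′ : B₁ ∖ B₂′ ⊆ B₁ ∖ B₂
      from-B₂′ (w∈B₁ , w∉B₂′) = w∈B₁ , λ w∈B₂ → w∉B₂′ (inj₁ (w∈B₂ , λ { refl → y∉B₁ w∈B₁ }))

      to-B₂′ : B₁ ∖ B₂ ⊆ ｛ x ｝ ∪ (B₁ ∖ B₂′)
      to-B₂′ w∈B₁∖B₂ with split-off em {A = B₁ ∖ B₂} {x = x} w∈B₁∖B₂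
      ... | inj₁ x≡w = inj₁ x≡w
      ... | inj₂ ((w∈B₁ , w∉B₂) , x≢w) =
        inj₂ (w∈B₁ , [ (λ (w∈B₂ , _) → w∉B₂ w∈B₂) , (λ w≡x → x≢w (sym w≡x)) ]′)

  basis-complement-card : IsBasis M Z B₁ → IsBasis M Z B₂ → HasFinCard (Z ∖ B₁) n → HasFinCard (Z ∖ B₂) n
  basis-complement-card {Z = Z} {B₁ = B₁} {B₂ = B₂} B₁-basis B₂-basis h =
    card-≐ (≐-sym (complement-split em {C = B₁} {A = B₂} (basis-⊆ B₁-basis)))
      (card-∪-cong em (complement-split-disjoint {Z = Z} {A = B₁} {C = B₂})
                      (complement-split-disjoint {Z = Z} {A = B₂} {C = B₁})
        (card-≐ (complement-swap {Z = Z} {A = B₁} {C = B₂})) (basis-diff-card B₁-basis B₂-basis)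
        (card-≐ (complement-split em {C = B₂} {A = B₁} (basis-⊆ B₂-basis)) h))

  conn-value-rebase : IsBasis M (I ∪ J) B → IsBasis M (I ∪ J) B′ → ConnValue I J B n → ConnValue I J B′ n
  conn-value-rebase B-basis B′-basis (a , b , h∩ , h∖ , eq) =
    a , b , h∩ , basis-complement-card B-basis B′-basis h∖ , eq

  conn-value-basisˡ : IsBasis M X A → IsBasis M X A′ → IsBasis M (A ∪ J) B → IsBasis M (A′ ∪ J) B′ →
                      ConnValue A J B n → ConnValue A′ J B′ n
  conn-value-basisˡ {X = X} {A = A} {A′ = A′} {J = J} A-basis A′-basis B-basis B′-basis value
    with extend-basis-outside {J = J} A-basis
  ... | Q , Q⊥X , Q⊆J , A∪Q-basis =
    conn-value-rebase (basis-swap A-basis A′-basis Q⊥X Q⊆J A∪Q-basis) B′-basis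
      (Equivalence.from (conn-value-count em (Q⊥ A′-basis))
        (Equivalence.to (conn-value-count em (Q⊥ A-basis))
          (conn-value-rebase B-basis A∪Q-basis value)))
    where
    Q⊥ : IsBasis M X C → Q ∩ C ⊆ ∅
    Q⊥ C-basis (q , c) = Q⊥X (q , basis-⊆ C-basis c)

  conn-value-basisʳ : IsBasis M Y J → IsBasis M Y J′ → IsBasis M (I ∪ J) B → IsBasis M (I ∪ J′) B′ →
                      ConnValue I J B n → ConnValue I J′ B′ n
  conn-value-basisʳ {J = J} {J′ = J′} {I = I} J-basis J′-basis B-basis B′-basis value =
    conn-value-comm (conn-value-basisˡ J-basis J′-basis
      (basis-≐ (∪-comm I J) ≐-refl B-basis) (basis-≐ (∪-comm I J′) ≐-refl B′-basis) (conn-value-comm value))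

  frame-invariant : (F F′ : Frame M X Y) → Frame.Value F n → Frame.Value F′ n
  frame-invariant (frame {J = J} I-basis J-basis B-basis) (frame {I = I′} I′-basis J′-basis B′-basis) value
    with basis-exists (I′ ∪ J)
  ... | B₁ , B₁-basis =
    conn-value-basisʳ J-basis J′-basis B₁-basis B′-basis
      (conn-value-basisˡ I-basis I′-basis B-basis B₁-basis value)

  local-conn-value : LocalConn M X Y (fin n) → (F : Frame M X Y) → Frame.Value F n
  local-conn-value (_ , _ , I-basis , J-basis , fin a , fin b , h∩ , (_ , B-basis , h∖) , refl) F =
    frame-invariant (frame I-basis J-basis B-basis) F (a , b , h∩ , h∖ , refl)
  local-conn-value (_ , _ , _ , _ , fin _ , ∞ , _ , _ , ()) _
  local-conn-value (_ , _ , _ , _ , ∞ , _ , _ , _ , ()) _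

  -- Comparison with r(X ∩ Y)

  frame-through : IsBasis M (X ∩ Y) K → Σ (Frame M X Y) λ F → Frame.I F ∩ Frame.J F ≐ K
  frame-through {X = X} {Y = Y} {K = K} K-basis
    with basis-extending {X = X} (basis-ind K-basis) (λ k → proj₁ (basis-⊆ K-basis k))
       | basis-extending {X = Y} (basis-ind K-basis) (λ k → proj₂ (basis-⊆ K-basis k))
  ... | I , I-basis , K⊆I | J , J-basis , K⊆J with basis-exists (I ∪ J)
  ... | B , B-basis = frame I-basis J-basis B-basis , I∩J⊆K , K⊆I∩J
    where
    K⊆I∩J : K ⊆ I ∩ J
    K⊆I∩J k = K⊆I k , K⊆J k

    I∩J⊆K : I ∩ J ⊆ K
    I∩J⊆K = basis-max K-basis (I2 M (basis-ind I-basis) proj₁)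
              (λ (i , j) → basis-⊆ I-basis i , basis-⊆ J-basis j) K⊆I∩J

  ∩-basis-value : LocalConn M X Y (fin n) → IsBasis M (X ∩ Y) K →
                  Σ (Frame M X Y) λ F → ∃₂ λ a b →
                    HasFinCard K a × HasFinCard ((Frame.I F ∪ Frame.J F) ∖ Frame.B F) b × a + b ≡ n
  ∩-basis-value conn K-basis with frame-through K-basis
  ... | F , I∩J≐K with local-conn-value conn F
  ... | a , b , h∩ , h∖ , eq = F , a , b , card-≐ I∩J≐K h∩ , h∖ , eq

  modular-frame : ModularPair M X Y → Σ (Frame M X Y) λ F → (Frame.I F ∪ Frame.J F) ∖ Frame.B F ⊆ ∅
  modular-frame (B₀ , B₀-ind , X-basis , Y-basis) =
    frame X-basis Y-basis (self-basis (I2 M B₀-ind [ proj₁ , proj₁ ]′)) , λ (u , u∉) → u∉ u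

  rank-∩-≤-local-conn : (p q : ℕ∞) → LocalConn M X Y p → Rank M (X ∩ Y) q → q ≤∞ p
  rank-∩-≤-local-conn (fin n) q conn (K , K-basis , K-card) with ∩-basis-value conn K-basis
  ... | _ , a , b , hK , _ , refl = bound q K-card
    where
    bound : ∀ q → Card K q → q ≤∞ fin (a + b)
    bound (fin m) hm = subst (_≤ a + b) (sym (card-unique hm hK)) (m≤m+n a b)
    bound ∞ K-infinite = ⊥-elim (K-infinite a hK)
  rank-∩-≤-local-conn ∞ (fin _) _ _ = tt
  rank-∩-≤-local-conn ∞ ∞ _ _ = tt

  rank-∩⇒modular : LocalConn M X Y (fin n) → Rank M (X ∩ Y) (fin n) → ModularPair M X Y
  rank-∩⇒modular conn (K , K-basis , K-card) with ∩-basis-value conn K-basis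
  ... | frame {I} {J} {B} I-basis J-basis B-basis , a , b , hK , h∖ , a+b≡n with card-unique K-card hK
  ... | refl = I ∪ J , I∪J-ind , basis-∩ I-basis I∪J-ind inj₁ , basis-∩ J-basis I∪J-ind inj₂
    where
    b≡0 : b ≡ 0
    b≡0 = +-cancelˡ-≡ a b 0 (trans a+b≡n (sym (+-identityʳ a)))

    I∪J⊆B : I ∪ J ⊆ B
    I∪J⊆B {y} y∈I∪J with em {B y}
    ... | yes y∈B = y∈B
    ... | no  y∉B = ⊥-elim (card-0⇒empty (subst (HasFinCard _) b≡0 h∖) (y∈I∪J , y∉B))

    I∪J-ind : Ind M (I ∪ J)
    I∪J-ind = I2 M (basis-ind B-basis) I∪J⊆B

  modular⇒rank-∩ : LocalConn M X Y (fin n) → ModularPair M X Y → Rank M (X ∩ Y) (fin n)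
  modular⇒rank-∩ {n = n} conn modular with modular-frame modular
  ... | F@(frame {I} {J} I-basis J-basis _) , I∪J-spanned
    with local-conn-value conn F
       | basis-extending (I2 M (basis-ind I-basis) proj₁) (λ (i , j) → basis-⊆ I-basis i , basis-⊆ J-basis j)
  ... | a , b , h∩ , h∖ , a+b≡n | K , K-basis , I∩J⊆K with ∩-basis-value conn K-basis
  ... | _ , k , c , hK , _ , k+c≡n = K , K-basis , subst (HasFinCard K) (≤-antisym k≤n n≤k) hK
    where
    a≡n : a ≡ n
    a≡n = trans (sym (+-identityʳ a))
                (subst (λ b → a + b ≡ n) (card-unique h∖ (empty⇒card-0 I∪J-spanned)) a+b≡n)

    k≤n : k ≤ n
    k≤n = subst (k ≤_) k+c≡n (m≤m+n k c)

    n≤k : n ≤ k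
    n≤k = card-mono I∩J⊆K (subst (HasFinCard (I ∩ J)) a≡n h∩) hK

mainTheorem12 : ExcludedMiddle 0ℓ → ExcludedMiddle (lsuc 0ℓ) →
    {E : Set} (M : Matroid E) (X Y : Subset E) →
    (∀ (p q : ℕ∞) → LocalConn M X Y p → Rank M (X ∩ Y) q → q ≤∞ p)
    × (∀ (n : ℕ) → LocalConn M X Y (fin n) →
         (Rank M (X ∩ Y) (fin n) ⇔ ModularPair M X Y))
mainTheorem12 em em1 M X Y =
  rank-∩-≤-local-conn , λ n conn → mk⇔ (rank-∩⇒modular conn) (modular⇒rank-∩ conn)
  where
  open Properties em em1 M
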